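{- Let $\vec U$ be a submodular universe and $k\in\mathbb N$. Let $P$ be a regular $k$-profile in $\vec U$ and let $D_P\subseteq P$ contain, for every regular $k$-profile $P'\neq P$ in $\vec U$, a separation which efficiently distinguishes $P$ from $P'$. Let $m$ be the number of maximal elements of $D_P$. Then $\delta_e(P)\le m$.
   Context: A separation system is a finite poset with an order-reversing involution ${}^*$; write $\overleftarrow s:=\vec s^{\,*}$, $s:=\{\vec s,\overleftarrow s\}$. $\vec s$ is small if $\vec s\le\overleftarrow s$, then $\overleftarrow s$ is cosmall. A universe $\vec U$ is a separation system whose poset is a lattice ($\vee,\wedge$); it is submodular if it carries $|\cdot|:\vec U\to\mathbb N_0$ with $|\vec s|=|\overleftarrow s|=:|s|$ and $|\vec s|+|\vec t|\ge|\vec s\vee\vec t|+|\vec s\wedge\vec t|$. $\vec S_k:=\{\vec s\in\vec U:|\vec s|<k\}$. A $k$-profile in $\vec U$ is a consistent orientation $P$ of $S_k$ (exactly one orientation of each $s\in S_k$, no $\vec a,\vec b$ with $a\ne b$, $\overleftarrow a\le\vec b$) with $\overleftarrow a\wedge\overleftarrow b\notin P$ for all $\vec a,\vec b\in P$; regular if it contains no cosmall separation. $s$ distinguishes $O_1,O_2$ if some orientation has $\vec s\in O_1$, $\overleftarrow s\in O_2$; efficiently if moreover no $r\in U$ with $|r|<|s|$ distinguishes them. A star is a set $\sigma$ with $\vec a\le\overleftarrow b$ for all distinct $\vec a,\vec b\in\sigma$; $\sigma$ has $\mathrm{Eff}(P)$ if there are no $\vec a\in\sigma$, $\vec a'\in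 P$ with $\vec a\le\vec a'$ and $|a'|<|a|$. $\delta_e(P)$ denotes the minimal size of a star $\sigma\subseteq P$ with $\mathrm{Eff}(P)$ which distinguishes $P$ from every other regular profile of $S_k$ (every other regular profile contains $\overleftarrow s$ for some $\vec s\in\sigma$). -}

module Defs where

open import Level using (0ℓ)
open import Data.Nat as ℕ using (ℕ; _+_)
open import Data.Fin using (Fin)
open import Data.Fin.Subset using (Subset; _∈_; _∉_; _⊆_; ∣_∣)
open import Data.Product using (Σ; _×_; ∃-syntax)
open import Data.Sum using (_⊎_)
open import Relation.Nullary using (¬_)
open import Relation.Binary using (Rel)
open import Relation.Binary.PropositionalEquality using (_≡_; _≢_)
open import Relation.Binary.Lattice.Structures using (IsLattice)

record SubmodularUniverse (n : ℕ) : Set₁ where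
  infix 4 _≤_
  infixr 6 _∨_
  infixr 7 _∧_
  field
    _≤_ : Rel (Fin n) 0ℓ
    _* : Fin n → Fin n
    _∨_ : Fin n → Fin n → Fin n
    _∧_ : Fin n → Fin n → Fin n
    isLattice : IsLattice _≡_ _≤_ _∨_ _∧_
    *-involutive : ∀ s → (s *) * ≡ s
    *-reversing : ∀ {s t} → s ≤ t → t * ≤ s *
    ∣_∣ₛ : Fin n → ℕ
    ∣*∣ : ∀ s → ∣ s * ∣ₛ ≡ ∣ s ∣ₛ
    submodular : ∀ s t → ∣ s ∨ t ∣ₛ + ∣ s ∧ t ∣ₛ ℕ.≤ ∣ s ∣ₛ + ∣ t ∣ₛ

module _ {n : ℕ} (U : SubmodularUniverse n) where
  open SubmodularUniverse U

  SameSep : Fin n → Fin n → Set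
  SameSep s t = t ≡ s ⊎ t ≡ s *

  record IsProfile (k : ℕ) (P : Subset n) : Set where
    field
      inSk : ∀ s → s ∈ P → ∣ s ∣ₛ ℕ.< k
      orients : ∀ s → ∣ s ∣ₛ ℕ.< k → s ∈ P ⊎ s * ∈ P
      atMostOne : ∀ s → s ∈ P → s * ∈ P → s ≡ s *
      consistent : ∀ a b → a ∈ P → b ∈ P → ¬ SameSep a b → ¬ (a * ≤ b)
      profile : ∀ a b → a ∈ P → b ∈ P → (a * ∧ b *) ∉ P

  -- regular: contains no cosmall separation (s is cosmall iff s* ≤ s)
  IsRegular : Subset n → Set
  IsRegular P = ∀ s → s ∈ P → ¬ (s * ≤ s)

  IsRegularProfile : ℕ → Subset n → Set
  IsRegularProfile k P = IsProfile k P × IsRegular P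

  Distinguishes : Fin n → Subset n → Subset n → Set
  Distinguishes s O₁ O₂ = (s ∈ O₁ × s * ∈ O₂) ⊎ (s * ∈ O₁ × s ∈ O₂)

  EffDistinguishes : Fin n → Subset n → Subset n → Set
  EffDistinguishes s O₁ O₂ =
    Distinguishes s O₁ O₂ × (∀ r → ∣ r ∣ₛ ℕ.< ∣ s ∣ₛ → ¬ Distinguishes r O₁ O₂)

  IsStar : Subset n → Set
  IsStar σ = ∀ a b → a ∈ σ → b ∈ σ → a ≢ b → a ≤ b *

  Eff : Subset n → Subset n → Set
  Eff P σ = ∀ a a' → a ∈ σ → a' ∈ P → a ≤ a' → ¬ (∣ a' ∣ₛ ℕ.< ∣ a ∣ₛ)

  DistinguishesFromOthers : ℕ → Subset n → Subset n → Set
  DistinguishesFromOthers k P σ =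
    ∀ P' → IsRegularProfile k P' → P' ≢ P → ∃[ s ] (s ∈ σ × s * ∈ P')

  IsDeltaEStar : ℕ → Subset n → Subset n → Set
  IsDeltaEStar k P σ = σ ⊆ P × IsStar σ × Eff P σ × DistinguishesFromOthers k P σ

  -- δ_e(P) ≤ d  (δ_e(P) is the minimum of ∣σ∣ over such stars)
  DeltaE≤ : ℕ → Subset n → ℕ → Set
  DeltaE≤ k P d = ∃[ σ ] (IsDeltaEStar k P σ × ∣ σ ∣ ℕ.≤ d)

  IsMaximalIn : Subset n → Fin n → Set
  IsMaximalIn D s = s ∈ D × (∀ t → t ∈ D → s ≤ t → t ≡ s)

{-# OPTIONS --safe #-}

-- The maximal elements of D lie in P, and every other regular profile P' contains t* for one of
-- them, because regular profiles are down-closed. Starting from this family, repeatedly replace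
-- one of its members a: by some a' ∈ P above a with ∣a'∣ < ∣a∣ if a violates Eff(P), or by the
-- corner a ∧ b* if a and another member b do not form a star (swapping a and b if necessary, so
-- that ∣a ∧ b*∣ ≤ ∣a∣ by submodularity). Each replacement keeps the family inside P and
-- distinguishing P from all other regular profiles, and strictly lowers its total weight, where a
-- separation weighs lexicographically by its order and then by the number of separations below
-- it. When no replacement applies, the family is a star with Eff(P) of size at most m.
module Submission where

open import Defs
open import Data.Nat using (ℕ)
open import Data.Fin using (Fin)
open import Data.Fin.Subset using (Subset; _∈_; _⊆_; ∣_∣)
open import Data.Product using (_×_; ∃-syntax)
open import Function.Bundles using (_⇔_)
open import Relation.Binary.PropositionalEquality using (_≢_)

open import Level using (0ℓ)
open import Data.Bool using (true; false; if_then_else_)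
open import Data.Bool.Properties using (T-≡)
open import Data.Empty using (⊥-elim)
open import Data.Fin using (zero; suc; _≟_)
open import Data.Fin.Properties using (any?)
open import Data.Fin.Subset using (⊥; ⁅_⁆; _∪_; _∉_)
open import Data.Fin.Subset.Properties
  using ( _∈?_; x∈⁅x⁆; x∈⁅y⁆⇒x≡y; x∈p∪q⁺; x∈p∪q⁻; ∪-identityˡ; ∉⊥; ∣⊥∣≡0; ∣p∣≤∣x∷p∣; ∣p∣≤n
        ; p⊂q⇒∣p∣<∣q∣ )
open import Data.List using (List; []; _∷_; length; map; foldr)
open import Data.List.Properties using (length-map)
open import Data.List.Membership.Propositional using (find; lose) renaming (_∈_ to _∈ₗ_)
open import Data.List.Membership.Propositional.Properties using (∈-map⁺; ∈-map⁻)
open import Data.List.Relation.Unary.Any as ListAny using (Any; here; there)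
open import Data.Nat as ℕ using (_+_; _<_; z≤n; s≤s)
open import Data.Nat.Induction using (<-wellFounded)
open import Data.Nat.ListAction using (sum)
import Data.Nat.Properties as ℕ
open import Data.Product using (_,_; proj₁; proj₂)
open import Data.Sum using (_⊎_; inj₁; inj₂)
open import Data.Vec using ([]; _∷_; tabulate; lookup)
import Data.Vec as Vec
open import Data.Vec.Properties using (lookup∘tabulate; []=⇒lookup; lookup⇒[]=)
open import Function using (_∘_; flip)
open import Function.Bundles using (Equivalence)
open import Induction.WellFounded using (Acc; acc)
open import Relation.Binary using (Rel; Decidable; DecidableEquality; IsPartialOrder)
import Relation.Binary.Construct.Flip.EqAndOrd as Flip
open import Relation.Binary.Lattice.Bundles using (Lattice)
open import Relation.Binary.Lattice.Structures using (IsLattice)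
import Relation.Binary.Lattice.Properties.JoinSemilattice as JoinSemilatticeProperties
open import Relation.Binary.PropositionalEquality
  using (_≡_; refl; sym; trans; cong; subst; module ≡-Reasoning)
open import Relation.Nullary using (¬_; Dec; does; yes; no; ¬?; contradiction)
open import Relation.Nullary.Decidable using (⌊_⌋; isYes≗does; toWitness; dec-true; _×-dec_)

toList : ∀ {n} → Subset n → List (Fin n)
toList [] = []
toList (true ∷ p) = zero ∷ map suc (toList p)
toList (false ∷ p) = map suc (toList p)

length-toList : ∀ {n} (p : Subset n) → length (toList p) ≡ ∣ p ∣
length-toList [] = refl
length-toList (true ∷ p) = cong ℕ.suc (trans (length-map suc (toList p)) (length-toList p))
length-toList (false ∷ p) = trans (length-map suc (toList p)) (length-toList p)

∈-toList⁺ : ∀ {n} {x : Fin n} {p} → x ∈ p → x ∈ₗ toList p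
∈-toList⁺ {p = true ∷ p} Vec.here = here refl
∈-toList⁺ {p = true ∷ p} (Vec.there x∈p) = there (∈-map⁺ suc (∈-toList⁺ x∈p))
∈-toList⁺ {p = false ∷ p} (Vec.there x∈p) = ∈-map⁺ suc (∈-toList⁺ x∈p)

∈-toList⁻ : ∀ {n} {x : Fin n} p → x ∈ₗ toList p → x ∈ p
∈-toList⁻ (true ∷ p) (here refl) = Vec.here
∈-toList⁻ (true ∷ p) (there x∈) with ∈-map⁻ suc x∈
... | _ , y∈ , refl = Vec.there (∈-toList⁻ p y∈)
∈-toList⁻ (false ∷ p) x∈ with ∈-map⁻ suc x∈
... | _ , y∈ , refl = Vec.there (∈-toList⁻ p y∈)

fromList : ∀ {n} → List (Fin n) → Subset n
fromList = foldr (λ x p → ⁅ x ⁆ ∪ p) ⊥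

∈-fromList⁺ : ∀ {n} {x : Fin n} {xs} → x ∈ₗ xs → x ∈ fromList xs
∈-fromList⁺ (here refl) = x∈p∪q⁺ (inj₁ (x∈⁅x⁆ _))
∈-fromList⁺ (there x∈) = x∈p∪q⁺ (inj₂ (∈-fromList⁺ x∈))

∈-fromList⁻ : ∀ {n} {x : Fin n} xs → x ∈ fromList xs → x ∈ₗ xs
∈-fromList⁻ [] x∈ = ⊥-elim (∉⊥ x∈)
∈-fromList⁻ (y ∷ xs) x∈ with x∈p∪q⁻ ⁅ y ⁆ (fromList xs) x∈
... | inj₁ x∈⁅y⁆ = here (x∈⁅y⁆⇒x≡y y x∈⁅y⁆)
... | inj₂ x∈xs = there (∈-fromList⁻ xs x∈xs)

∣⁅x⁆∪p∣≤1+∣p∣ : ∀ {n} (x : Fin n) p → ∣ ⁅ x ⁆ ∪ p ∣ ℕ.≤ ℕ.suc ∣ p ∣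
∣⁅x⁆∪p∣≤1+∣p∣ zero (b ∷ p) rewrite ∪-identityˡ p = s≤s (∣p∣≤∣x∷p∣ b p)
∣⁅x⁆∪p∣≤1+∣p∣ (suc x) (true ∷ p) = s≤s (∣⁅x⁆∪p∣≤1+∣p∣ x p)
∣⁅x⁆∪p∣≤1+∣p∣ (suc x) (false ∷ p) = ∣⁅x⁆∪p∣≤1+∣p∣ x p

∣fromList∣≤length : ∀ {n} (xs : List (Fin n)) → ∣ fromList xs ∣ ℕ.≤ length xs
∣fromList∣≤length {n} [] = ℕ.≤-reflexive (∣⊥∣≡0 n)
∣fromList∣≤length (x ∷ xs) =
  ℕ.≤-trans (∣⁅x⁆∪p∣≤1+∣p∣ x (fromList xs)) (s≤s (∣fromList∣≤length xs))

module _ {A : Set} (w : A → ℕ) (f : A → A) (f-lighter : ∀ x → w (f x) ℕ.≤ w x) where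

  sum-map-mono-≤ : ∀ xs → sum (map w (map f xs)) ℕ.≤ sum (map w xs)
  sum-map-mono-≤ [] = z≤n
  sum-map-mono-≤ (x ∷ xs) = ℕ.+-mono-≤ (f-lighter x) (sum-map-mono-≤ xs)

  sum-map-mono-< : ∀ {a xs} → a ∈ₗ xs → w (f a) < w a
                 → sum (map w (map f xs)) < sum (map w xs)
  sum-map-mono-< {xs = x ∷ xs} (here refl) lt = ℕ.+-mono-<-≤ lt (sum-map-mono-≤ xs)
  sum-map-mono-< {xs = x ∷ xs} (there a∈) lt =
    ℕ.+-mono-≤-< (f-lighter x) (sum-map-mono-< a∈ lt)

module Replace {A : Set} (_≟ᴬ_ : DecidableEquality A) where

  replace : A → A → A → A
  replace a x t = if ⌊ t ≟ᴬ a ⌋ then x else t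

  replace-target : ∀ a x → replace a x a ≡ x
  replace-target a x with a ≟ᴬ a
  ... | yes _ = refl
  ... | no a≢a = contradiction refl a≢a

  replace-other : ∀ a x {t} → t ≢ a → replace a x t ≡ t
  replace-other a x {t} t≢a with t ≟ᴬ a
  ... | yes t≡a = contradiction t≡a t≢a
  ... | no _ = refl

  replace-cases : ∀ a x t → replace a x t ≡ x ⊎ replace a x t ≡ t
  replace-cases a x t with t ≟ᴬ a
  ... | yes _ = inj₁ refl
  ... | no _ = inj₂ refl

  ∈-replace-target : ∀ {a x xs} → a ∈ₗ xs → x ∈ₗ map (replace a x) xs
  ∈-replace-target {a} {x} {xs} a∈ =
    subst (_∈ₗ map (replace a x) xs) (replace-target a x) (∈-map⁺ (replace a x) a∈)

  ∈-replace-other : ∀ {a x t xs} → t ∈ₗ xs → t ≢ a → t ∈ₗ map (replace a x) xs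
  ∈-replace-other {a} {x} {xs = xs} t∈ t≢a =
    subst (_∈ₗ map (replace a x) xs) (replace-other a x t≢a) (∈-map⁺ (replace a x) t∈)

  ∈-replace⁻ : ∀ a x {t xs} → t ∈ₗ map (replace a x) xs → t ≡ x ⊎ t ∈ₗ xs
  ∈-replace⁻ a x {xs = xs} t∈ with ∈-map⁻ (replace a x) t∈
  ... | u , u∈ , refl with replace-cases a x u
  ...   | inj₁ eq = inj₁ eq
  ...   | inj₂ eq = inj₂ (subst (_∈ₗ _) (sym eq) u∈)

  sum-replace-< : ∀ (w : A → ℕ) {a x xs} → a ∈ₗ xs → w x < w a
                → sum (map w (map (replace a x) xs)) < sum (map w xs)
  sum-replace-< w {a} {x} a∈ lt =
    sum-map-mono-< w (replace a x) lighter a∈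
      (subst (λ y → w y < w a) (sym (replace-target a x)) lt)
    where
    lighter : ∀ t → w (replace a x t) ℕ.≤ w t
    lighter t with t ≟ᴬ a
    ... | yes refl = ℕ.<⇒≤ lt
    ... | no _ = ℕ.≤-refl

module FinitePoset {n : ℕ} {_≤_ : Rel (Fin n) 0ℓ}
                   (isPartialOrder : IsPartialOrder _≡_ _≤_) (_≤?_ : Decidable _≤_) where
  open IsPartialOrder isPartialOrder using (antisym) renaming (refl to ≤-refl; trans to ≤-trans)

  ⇓_ : Fin n → Subset n
  ⇓ x = tabulate (λ y → ⌊ y ≤? x ⌋)

  ∈⇓⁺ : ∀ {x y} → y ≤ x → y ∈ ⇓ x
  ∈⇓⁺ {x} {y} y≤x = lookup⇒[]= y (⇓ x) (begin
    lookup (⇓ x) y     ≡⟨ lookup∘tabulate _ y ⟩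
    ⌊ y ≤? x ⌋         ≡⟨ isYes≗does (y ≤? x) ⟩
    does (y ≤? x)      ≡⟨ dec-true (y ≤? x) y≤x ⟩
    true               ∎)
    where open ≡-Reasoning

  ∈⇓⁻ : ∀ {x y} → y ∈ ⇓ x → y ≤ x
  ∈⇓⁻ {x} {y} y∈ =
    toWitness (Equivalence.from T-≡ (trans (sym (lookup∘tabulate _ y)) ([]=⇒lookup y∈)))

  ∣⇓∣-mono-< : ∀ {x y} → x ≤ y → x ≢ y → ∣ ⇓ x ∣ < ∣ ⇓ y ∣
  ∣⇓∣-mono-< x≤y x≢y = p⊂q⇒∣p∣<∣q∣
    ( (λ z∈ → ∈⇓⁺ (≤-trans (∈⇓⁻ z∈) x≤y))
    , _ , ∈⇓⁺ ≤-refl , λ y∈ → x≢y (antisym x≤y (∈⇓⁻ y∈)) )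

module FiniteMaximal {n : ℕ} {_≤_ : Rel (Fin n) 0ℓ}
                     (isPartialOrder : IsPartialOrder _≡_ _≤_) (_≤?_ : Decidable _≤_) where
  open IsPartialOrder isPartialOrder using () renaming (refl to ≤-refl; trans to ≤-trans)
  open FinitePoset (Flip.isPartialOrder isPartialOrder) (flip _≤?_)
    using () renaming (⇓_ to ⇑_; ∣⇓∣-mono-< to ∣⇑∣-anti-<)

  Maximal : Subset n → Fin n → Set
  Maximal D t = t ∈ D × (∀ u → u ∈ D → t ≤ u → u ≡ t)

  below-maximal : ∀ (D : Subset n) {s} → s ∈ D → ∃[ t ] (Maximal D t × s ≤ t)
  below-maximal D {s} s∈D = go s (<-wellFounded ∣ ⇑ s ∣) s∈D
    where
    go : ∀ s → Acc _<_ ∣ ⇑ s ∣ → s ∈ D → ∃[ t ] (Maximal D t × s ≤ t)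
    go s (acc rec) s∈D with any? (λ u → (u ∈? D) ×-dec (s ≤? u) ×-dec ¬? (u ≟ s))
    ... | yes (u , u∈D , s≤u , u≢s) with go u (rec (∣⇑∣-anti-< s≤u u≢s)) u∈D
    ...   | t , max , u≤t = t , max , ≤-trans s≤u u≤t
    go s (acc rec) s∈D | no noneAbove = s , (s∈D , maximal) , ≤-refl
      where
      maximal : ∀ u → u ∈ D → s ≤ u → u ≡ s
      maximal u u∈D s≤u with u ≟ s
      ... | yes u≡s = u≡s
      ... | no u≢s = contradiction (u , u∈D , s≤u , u≢s) noneAbove

module Universe {n : ℕ} (U : SubmodularUniverse n) where
  open SubmodularUniverse U
  open IsLattice isLattice
    using (isPartialOrder; antisym; x≤x∨y; y≤x∨y; ∨-least; x∧y≤x; x∧y≤y; ∧-greatest)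
    renaming (refl to ≤-refl)

  lattice : Lattice 0ℓ 0ℓ 0ℓ
  lattice = record { isLattice = isLattice }

  open JoinSemilatticeProperties (Lattice.joinSemilattice lattice) using (∨-comm)

  infix 4 _≤?_
  _≤?_ : Decidable _≤_
  x ≤? y with x ∧ y ≟ x
  ... | yes x∧y≡x = yes (subst (_≤ y) x∧y≡x (x∧y≤y x y))
  ... | no x∧y≢x = no (λ x≤y → x∧y≢x (antisym (x∧y≤x x y) (∧-greatest ≤-refl x≤y)))

  open FinitePoset isPartialOrder _≤?_ using (⇓_; ∣⇓∣-mono-<)
  open FiniteMaximal isPartialOrder _≤?_ public using (below-maximal)

  *-adjointʳ : ∀ {a b} → a ≤ b * → b ≤ a *
  *-adjointʳ {a} {b} a≤b* = subst (_≤ a *) (*-involutive b) (*-reversing a≤b*)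

  *-adjointˡ : ∀ {a b} → a * ≤ b → b * ≤ a
  *-adjointˡ {a} {b} a*≤b = subst (b * ≤_) (*-involutive a) (*-reversing a*≤b)

  *-∧ : ∀ x y → (x ∧ y) * ≡ x * ∨ y *
  *-∧ x y = antisym
    (subst ((x ∧ y) * ≤_) (*-involutive _)
      (*-reversing (∧-greatest (*-adjointˡ (x≤x∨y (x *) (y *))) (*-adjointˡ (y≤x∨y (x *) (y *))))))
    (∨-least (*-reversing (x∧y≤x x y)) (*-reversing (x∧y≤y x y)))

  uncrossing-either : ∀ a b → ∣ a ∧ b * ∣ₛ ℕ.≤ ∣ a ∣ₛ ⊎ ∣ b ∧ a * ∣ₛ ℕ.≤ ∣ b ∣ₛ
  uncrossing-either a b with ∣ a ∧ b * ∣ₛ ℕ.≤? ∣ a ∣ₛ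
  ... | yes le = inj₁ le
  ... | no ≰ = inj₂ (ℕ.<⇒≤ (subst (_< ∣ b ∣ₛ) (sym corner≡join) join<b))
    where
    corner≡join : ∣ b ∧ a * ∣ₛ ≡ ∣ a ∨ b * ∣ₛ
    corner≡join = begin
      ∣ b ∧ a * ∣ₛ        ≡⟨ sym (∣*∣ _) ⟩
      ∣ (b ∧ a *) * ∣ₛ    ≡⟨ cong ∣_∣ₛ (*-∧ b (a *)) ⟩
      ∣ b * ∨ a * * ∣ₛ    ≡⟨ cong (λ z → ∣ b * ∨ z ∣ₛ) (*-involutive a) ⟩
      ∣ b * ∨ a ∣ₛ        ≡⟨ cong ∣_∣ₛ (∨-comm (b *) a) ⟩
      ∣ a ∨ b * ∣ₛ        ∎
      where open ≡-Reasoning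
    join<b : ∣ a ∨ b * ∣ₛ < ∣ b ∣ₛ
    join<b = ℕ.+-cancelʳ-< ∣ a ∣ₛ ∣ a ∨ b * ∣ₛ ∣ b ∣ₛ (begin-strict
      ∣ a ∨ b * ∣ₛ + ∣ a ∣ₛ           <⟨ ℕ.+-monoʳ-< ∣ a ∨ b * ∣ₛ (ℕ.≰⇒> ≰) ⟩
      ∣ a ∨ b * ∣ₛ + ∣ a ∧ b * ∣ₛ     ≤⟨ submodular a (b *) ⟩
      ∣ a ∣ₛ + ∣ b * ∣ₛ               ≡⟨ cong (∣ a ∣ₛ +_) (∣*∣ b) ⟩
      ∣ a ∣ₛ + ∣ b ∣ₛ                 ≡⟨ ℕ.+-comm ∣ a ∣ₛ ∣ b ∣ₛ ⟩
      ∣ b ∣ₛ + ∣ a ∣ₛ                 ∎)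
      where open ℕ.≤-Reasoning

  module _ {k : ℕ} {Q : Subset n} (regQ : IsRegularProfile U k Q) where
    open IsProfile (proj₁ regQ)

    regularProfile-∉* : ∀ {s} → s ∈ Q → s * ∉ Q
    regularProfile-∉* {s} s∈Q s*∈Q =
      proj₂ regQ s s∈Q (subst (s * ≤_) (sym (atMostOne s s∈Q s*∈Q)) ≤-refl)

    regularProfile-downClosed : ∀ {x y} → y ∈ Q → x ≤ y → ∣ x ∣ₛ < k → x ∈ Q
    regularProfile-downClosed {x} {y} y∈Q x≤y ∣x∣<k with orients x ∣x∣<k | y ≟ x
    ... | inj₁ x∈Q | _ = x∈Q
    ... | inj₂ _ | yes refl = y∈Q
    ... | inj₂ x*∈Q | no y≢x =
      ⊥-elim (consistent (x *) y x*∈Q y∈Q differentSep (subst (_≤ y) (sym (*-involutive x)) x≤y))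
      where
      differentSep : ¬ SameSep U (x *) y
      differentSep (inj₁ refl) = proj₂ regQ y y∈Q (subst (_≤ x *) (sym (*-involutive x)) x≤y)
      differentSep (inj₂ y≡x**) = y≢x (trans y≡x** (*-involutive x))

    regularProfile-*-upClosed : ∀ {x y} → y * ∈ Q → y ≤ x → ∣ x ∣ₛ < k → x * ∈ Q
    regularProfile-*-upClosed {x} y*∈Q y≤x ∣x∣<k =
      regularProfile-downClosed y*∈Q (*-reversing y≤x) (subst (_< k) (sym (∣*∣ x)) ∣x∣<k)

  -- Lexicographic in (∣ t ∣ₛ, ∣ ⇓ t ∣), since ∣ ⇓ t ∣ ≤ n.
  weight : Fin n → ℕ
  weight t = ∣ t ∣ₛ ℕ.* ℕ.suc n + ∣ ⇓ t ∣

  shorter⇒lighter : ∀ {x y} → ∣ x ∣ₛ < ∣ y ∣ₛ → weight x < weight y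
  shorter⇒lighter {x} {y} lt = begin-strict
    ∣ x ∣ₛ ℕ.* ℕ.suc n + ∣ ⇓ x ∣   ≤⟨ ℕ.+-monoʳ-≤ (∣ x ∣ₛ ℕ.* ℕ.suc n) (∣p∣≤n (⇓ x)) ⟩
    ∣ x ∣ₛ ℕ.* ℕ.suc n + n         <⟨ ℕ.+-monoʳ-< (∣ x ∣ₛ ℕ.* ℕ.suc n) (ℕ.n<1+n n) ⟩
    ∣ x ∣ₛ ℕ.* ℕ.suc n + ℕ.suc n   ≡⟨ ℕ.+-comm (∣ x ∣ₛ ℕ.* ℕ.suc n) (ℕ.suc n) ⟩
    ℕ.suc ∣ x ∣ₛ ℕ.* ℕ.suc n       ≤⟨ ℕ.*-monoˡ-≤ (ℕ.suc n) lt ⟩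
    ∣ y ∣ₛ ℕ.* ℕ.suc n             ≤⟨ ℕ.m≤m+n _ _ ⟩
    weight y                     ∎
    where open ℕ.≤-Reasoning

  below⇒lighter : ∀ {x y} → ∣ x ∣ₛ ℕ.≤ ∣ y ∣ₛ → x ≤ y → x ≢ y → weight x < weight y
  below⇒lighter ∣x∣≤∣y∣ x≤y x≢y = ℕ.+-mono-≤-< (ℕ.*-monoˡ-≤ (ℕ.suc n) ∣x∣≤∣y∣) (∣⇓∣-mono-< x≤y x≢y)

module Descent {n : ℕ} (U : SubmodularUniverse n) (k : ℕ) (P : Subset n)
            (regP : IsRegularProfile U k P) where
  open SubmodularUniverse U
  open IsLattice isLattice using (x∧y≤x; x∧y≤y)
  open Universe U
  open Replace (_≟_ {n})
  open IsProfile

  record Distinguishing (L : List (Fin n)) : Set where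
    field
      ⊆P : ∀ {t} → t ∈ₗ L → t ∈ P
      separates : ∀ P' → IsRegularProfile U k P' → P' ≢ P → ∃[ t ] (t ∈ₗ L × t * ∈ P')
  open Distinguishing

  listWeight : List (Fin n) → ℕ
  listWeight L = sum (map weight L)

  Improvement : List (Fin n) → Set
  Improvement L =
    ∃[ L' ] (Distinguishing L' × length L' ≡ length L × listWeight L' < listWeight L)

  ∈P⇒<k : ∀ {t} → t ∈ P → ∣ t ∣ₛ < k
  ∈P⇒<k = inSk (proj₁ regP) _

  replace-improves : ∀ {L a x} → Distinguishing L → a ∈ₗ L → x ∈ P → weight x < weight a
    → (∀ P' → IsRegularProfile U k P' → P' ≢ P → a * ∈ P'
         → x * ∈ P' ⊎ ∃[ b ] (b ∈ₗ L × b ≢ a × b * ∈ P'))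
    → Improvement L
  replace-improves {L} {a} {x} dL a∈L x∈P lighter cover =
    map (replace a x) L , dL' , length-map _ L , sum-replace-< weight a∈L lighter
    where
    dL' : Distinguishing (map (replace a x) L)
    dL' .⊆P t∈ with ∈-replace⁻ a x t∈
    ... | inj₁ refl = x∈P
    ... | inj₂ t∈L = ⊆P dL t∈L
    dL' .separates P' regP' P'≢P with separates dL P' regP' P'≢P
    ... | t , t∈L , t*∈P' with t ≟ a
    ...   | no t≢a = t , ∈-replace-other t∈L t≢a , t*∈P'
    ...   | yes refl with cover P' regP' P'≢P t*∈P'
    ...     | inj₁ x*∈P' = x , ∈-replace-target a∈L , x*∈P'
    ...     | inj₂ (b , b∈L , b≢a , b*∈P') = b , ∈-replace-other b∈L b≢a , b*∈P'

  Inefficient : Fin n → Set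
  Inefficient a = ∃[ a' ] (a' ∈ P × a ≤ a' × ∣ a' ∣ₛ < ∣ a ∣ₛ)

  inefficient? : ∀ a → Dec (Inefficient a)
  inefficient? a = any? (λ a' → (a' ∈? P) ×-dec (a ≤? a') ×-dec (∣ a' ∣ₛ ℕ.<? ∣ a ∣ₛ))

  Crossing : Fin n → Fin n → Set
  Crossing a b = a ≢ b × ¬ a ≤ b *

  crossing? : ∀ a b → Dec (Crossing a b)
  crossing? a b = ¬? (a ≟ b) ×-dec ¬? (a ≤? b *)

  shorten : ∀ {L a} → Distinguishing L → a ∈ₗ L → Inefficient a → Improvement L
  shorten dL a∈L (a' , a'∈P , a≤a' , shorter) =
    replace-improves dL a∈L a'∈P (shorter⇒lighter shorter) λ P' regP' _ a*∈P' →
      inj₁ (regularProfile-*-upClosed regP' a*∈P' a≤a' (∈P⇒<k a'∈P))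

  uncross : ∀ {L a b} → Distinguishing L → a ∈ₗ L → b ∈ₗ L → Crossing a b
          → ∣ a ∧ b * ∣ₛ ℕ.≤ ∣ a ∣ₛ → Improvement L
  uncross {L} {a} {b} dL a∈L b∈L (a≢b , a≰b*) corner≤ =
    replace-improves dL a∈L corner∈P (below⇒lighter corner≤ (x∧y≤x a (b *)) corner≢a) cover
    where
    corner<k : ∣ a ∧ b * ∣ₛ < k
    corner<k = ℕ.≤-<-trans corner≤ (∈P⇒<k (⊆P dL a∈L))
    corner∈P : a ∧ b * ∈ P
    corner∈P = regularProfile-downClosed regP (⊆P dL a∈L) (x∧y≤x a (b *)) corner<k
    corner≢a : a ∧ b * ≢ a
    corner≢a eq = a≰b* (subst (_≤ b *) eq (x∧y≤y a (b *)))
    -- Otherwise P' contains a*, b and a* * ∧ b*, violating the profile property.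
    cover : ∀ P' → IsRegularProfile U k P' → P' ≢ P → a * ∈ P'
          → (a ∧ b *) * ∈ P' ⊎ ∃[ c ] (c ∈ₗ L × c ≢ a × c * ∈ P')
    cover P' (prof' , _) _ a*∈P' with orients prof' b (∈P⇒<k (⊆P dL b∈L))
    ... | inj₂ b*∈P' = inj₂ (b , b∈L , a≢b ∘ sym , b*∈P')
    ... | inj₁ b∈P' with orients prof' (a ∧ b *) corner<k
    ...   | inj₂ corner*∈P' = inj₁ corner*∈P'
    ...   | inj₁ corner∈P' = ⊥-elim (profile prof' (a *) b a*∈P' b∈P'
            (subst (λ z → z ∧ b * ∈ P') (sym (*-involutive a)) corner∈P'))

  deltaEStar : ∀ {L} → Distinguishing L → ¬ Any Inefficient L → ¬ Any (λ a → Any (Crossing a) L) L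
             → IsDeltaEStar U k P (fromList L)
  deltaEStar {L} dL efficient star = ⊆P dL ∘ ∈-fromList⁻ L , isStar , isEff , distinguishes
    where
    isStar : IsStar U (fromList L)
    isStar a b a∈ b∈ a≢b with a ≤? b *
    ... | yes a≤b* = a≤b*
    ... | no a≰b* =
      contradiction (lose (∈-fromList⁻ L a∈) (lose (∈-fromList⁻ L b∈) (a≢b , a≰b*))) star
    isEff : Eff U P (fromList L)
    isEff a a' a∈ a'∈P a≤a' shorter =
      efficient (lose (∈-fromList⁻ L a∈) (a' , a'∈P , a≤a' , shorter))
    distinguishes : DistinguishesFromOthers U k P (fromList L)
    distinguishes P' regP' P'≢P with separates dL P' regP' P'≢P
    ... | t , t∈L , t*∈P' = t , ∈-fromList⁺ t∈L , t*∈P'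

  improve-or-star : ∀ {L} → Distinguishing L → Improvement L ⊎ IsDeltaEStar U k P (fromList L)
  improve-or-star {L} dL with ListAny.any? inefficient? L
  ... | yes someInefficient with find someInefficient
  ...   | a , a∈L , ineff = inj₁ (shorten dL a∈L ineff)
  improve-or-star {L} dL | no efficient with ListAny.any? (λ a → ListAny.any? (crossing? a) L) L
  ... | no star = inj₂ (deltaEStar dL efficient star)
  ... | yes someCrossing with find someCrossing
  ...   | a , a∈L , crossesA with find crossesA
  ...     | b , b∈L , crossing@(a≢b , a≰b*) with uncrossing-either a b
  ...       | inj₁ corner≤ = inj₁ (uncross dL a∈L b∈L crossing corner≤)
  ...       | inj₂ corner≤ = inj₁ (uncross dL b∈L a∈L (a≢b ∘ sym , a≰b* ∘ *-adjointʳ) corner≤)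

  deltaE≤length : ∀ {L} → Distinguishing L → DeltaE≤ U k P (length L)
  deltaE≤length {L} dL = go L (<-wellFounded (listWeight L)) dL
    where
    go : ∀ L → Acc _<_ (listWeight L) → Distinguishing L → DeltaE≤ U k P (length L)
    go L (acc rec) dL with improve-or-star dL
    ... | inj₂ star = fromList L , star , ∣fromList∣≤length L
    ... | inj₁ (L' , dL' , sameLength , lighter) =
      subst (DeltaE≤ U k P) sameLength (go L' (rec lighter) dL')

  -- The orientation of s in P is s itself, so s distinguishes P from P' only through s* ∈ P'.
  maximals-distinguishing : ∀ (D : Subset n) → D ⊆ P
    → (∀ P' → IsRegularProfile U k P' → P' ≢ P → ∃[ s ] (s ∈ D × Distinguishes U s P P'))
    → ∀ (M : Subset n) → (∀ s → (s ∈ M) ⇔ IsMaximalIn U D s)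
    → Distinguishing (toList M)
  maximals-distinguishing D D⊆P distD M M-max = record { ⊆P = M⊆P ; separates = separates' }
    where
    M⊆P : ∀ {t} → t ∈ₗ toList M → t ∈ P
    M⊆P t∈ = D⊆P (proj₁ (Equivalence.to (M-max _) (∈-toList⁻ M t∈)))
    separates' : ∀ P' → IsRegularProfile U k P' → P' ≢ P → ∃[ t ] (t ∈ₗ toList M × t * ∈ P')
    separates' P' regP' P'≢P with distD P' regP' P'≢P
    ... | s , s∈D , inj₂ (s*∈P , _) = contradiction s*∈P (regularProfile-∉* regP (D⊆P s∈D))
    ... | s , s∈D , inj₁ (_ , s*∈P') with below-maximal D s∈D
    ...   | t , max@(t∈D , _) , s≤t =
      t , ∈-toList⁺ (Equivalence.from (M-max t) max) ,
      regularProfile-*-upClosed regP' s*∈P' s≤t (∈P⇒<k (D⊆P t∈D))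

mainTheorem9 : ∀ {n : ℕ} (U : SubmodularUniverse n) (k : ℕ) (P : Subset n)
    → IsRegularProfile U k P
    → (D : Subset n) → D ⊆ P
    → (∀ P' → IsRegularProfile U k P' → P' ≢ P
         → ∃[ s ] (s ∈ D × EffDistinguishes U s P P'))
    → (M : Subset n) → (∀ s → (s ∈ M) ⇔ IsMaximalIn U D s)
    → DeltaE≤ U k P ∣ M ∣
mainTheorem9 U k P regP D D⊆P effDistD M M-max =
  subst (DeltaE≤ U k P) (length-toList M)
    (deltaE≤length (maximals-distinguishing D D⊆P distD M M-max))
  where
  open Descent U k P regP
  distD : ∀ P' → IsRegularProfile U k P' → P' ≢ P → ∃[ s ] (s ∈ D × Distinguishes U s P P')
  distD P' regP' P'≢P with effDistD P' regP' P'≢P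
  ... | s , s∈D , distinguishes , _ = s , s∈D , distinguishes
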